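{- Let $P$ be a sum indecomposable permutation matrix such that $t_P$ is to the left of $b_P$ or $\ell_P$ is above $r_P$. Then $P$ has a spanning oscillation.
   Context: A permutation matrix is a square 0-1 matrix with exactly one 1 in each row and column. 1-entries are identified with positions $(i,j)$ ($i$ = row counted from the top, $j$ = column counted from the left); $(i,j)$ is above $(i',j')$ if $i<i'$, below if $i>i'$, to the left if $j<j'$, to the right if $j>j'$. $\ell_P,r_P,t_P,b_P$ denote the leftmost, rightmost, topmost and bottommost 1-entries of $P$. $P$ is sum decomposable if it has the form $\begin{pmatrix}A&\mathbf{0}\\\mathbf{0}&B\end{pmatrix}$ with $A,B\neq\mathbf{0}$ (all-zero off-diagonal blocks), and sum indecomposable otherwise. The permutation graph $G_P$ has vertex set the set of 1-entries of $P$, with an edge between $x$ and $y$ iff one of them is below and to the left of the other. An oscillation is a sequence $(x_1,\dots,x_m)$ of distinct 1-entries of $P$ forming an induced path in $G_P$ (edges exactly between $x_i$ and $x_{i+1}$ for $i\in[m-1]$). It is spanning if $\{x_1,x_2\}=\{\ell_P,t_P\}$ and $\{x_{m-1},x_m\}=\{b_P,r_P\}$. -}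

module Defs where

open import Data.Nat using (ℕ; zero; suc; _+_; _<_; _≤_)
open import Data.Fin using (Fin; toℕ; fromℕ; inject₁)
open import Data.Bool using (Bool; true)
open import Data.Product using (Σ; ∃; ∃-syntax; ∃!; _×_; _,_; proj₁; proj₂)
open import Data.Sum using (_⊎_)
open import Relation.Binary.PropositionalEquality using (_≡_)
open import Function using (_⇔_)
open import Function.Definitions using (Injective)

-- An n×n 0-1 matrix: M i j = true means a 1-entry in row i (from top), column j (from left).
Matrix : ℕ → Set
Matrix n = Fin n → Fin n → Bool

IsPermutationMatrix : ∀ {n} → Matrix n → Set
IsPermutationMatrix {n} M =
  (∀ (i : Fin n) → ∃! _≡_ (λ j → M i j ≡ true)) ×
  (∀ (j : Fin n) → ∃! _≡_ (λ i → M i j ≡ true))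

Pos : ℕ → Set
Pos n = Fin n × Fin n

row col : ∀ {n} → Pos n → ℕ
row x = toℕ (proj₁ x)
col x = toℕ (proj₂ x)

One : ∀ {n} → Matrix n → Pos n → Set
One M x = M (proj₁ x) (proj₂ x) ≡ true

IsLeftmost IsRightmost IsTopmost IsBottommost : ∀ {n} → Matrix n → Pos n → Set
IsLeftmost   M x = One M x × (∀ y → One M y → col x ≤ col y)
IsRightmost  M x = One M x × (∀ y → One M y → col y ≤ col x)
IsTopmost    M x = One M x × (∀ y → One M y → row x ≤ row y)
IsBottommost M x = One M x × (∀ y → One M y → row y ≤ row x)

-- P = (A 0; 0 B) with A (a×b) and B ((n-a)×(n-b)) both nonzero
SumDecomposable : ∀ {n} → Matrix n → Set
SumDecomposable {n} M =
  ∃[ a ] ∃[ b ] (a ≤ n × b ≤ n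
    × (∀ x → One M x → row x < a → col x < b)
    × (∀ x → One M x → a ≤ row x → b ≤ col x)
    × (∃[ x ] (One M x × row x < a × col x < b))
    × (∃[ x ] (One M x × a ≤ row x × b ≤ col x)))

SumIndecomposable : ∀ {n} → Matrix n → Set
SumIndecomposable M = SumDecomposable M → Data.Empty.⊥
  where import Data.Empty

Edge : ∀ {n} → Pos n → Pos n → Set
Edge x y = (row y < row x × col x < col y) ⊎ (row x < row y × col y < col x)

IsOscillation : ∀ {n m} → Matrix n → (Fin m → Pos n) → Set
IsOscillation {n} {m} M xs =
  (∀ p → One M (xs p)) ×
  Injective _≡_ _≡_ xs ×
  (∀ p q → Edge (xs p) (xs q) ⇔ (toℕ p + 1 ≡ toℕ q ⊎ toℕ q + 1 ≡ toℕ p))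

-- spanning oscillation (x₁,…,x_m), m = k + 2 (needed so that x₁,x₂,x_{m-1},x_m exist):
-- {x₁,x₂} = {ℓ_P,t_P} and {x_{m-1},x_m} = {b_P,r_P} as sets of positions
IsSpanning : ∀ {n k} → Matrix n → (Fin (suc (suc k)) → Pos n) → Set
IsSpanning {n} {k} M xs =
  (∀ z → (z ≡ xs Fin.zero ⊎ z ≡ xs (Fin.suc Fin.zero)) ⇔ (IsLeftmost M z ⊎ IsTopmost M z)) ×
  (∀ z → (z ≡ xs (inject₁ (fromℕ k)) ⊎ z ≡ xs (fromℕ (suc k))) ⇔ (IsBottommost M z ⊎ IsRightmost M z))
  where import Data.Fin as Fin

HasSpanningOscillation : ∀ {n} → Matrix n → Set
HasSpanningOscillation M =
  ∃[ k ] Σ (Fin (suc (suc k)) → Pos _) (λ xs → IsOscillation M xs × IsSpanning M xs)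

{-# OPTIONS --safe #-}
module Submission where

-- Walk from ℓ by alternately moving to the bottommost 1-entry weakly left of the current one and to
-- the rightmost 1-entry weakly above it.  Whenever a double step fails to gain a row (resp. a column)
-- before b (resp. r) is reached, the rows and columns visited so far form a block A of a sum
-- decomposition, so indecomposability forces progress and the walk ends at {b, r}.  Consecutive
-- entries of the walk are adjacent in G_P, and entries two or more steps apart lie strictly south-east
-- of one another, so the walk is an induced path.  It starts at ℓ; t is then put in front of ℓ or in
-- place of the second entry, according to the side of t on which the third entry lies, and
-- col t < col b prevents the walk from ending before that.  The case "ℓ above r" is the transpose.

open import Defs
open import Data.Bool using (Bool; true; false; not)
open import Data.Empty using (⊥-elim)
open import Data.Fin as Fin using (Fin; toℕ; fromℕ; inject₁)
open import Data.Fin.Properties using (toℕ-injective; toℕ<n; toℕ-inject₁; toℕ-fromℕ; toℕ≤pred[n])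
open import Data.Nat using (ℕ; zero; suc; _+_; _∸_; _<_; _≤_; _≤?_; _<?_; z≤n; s≤s)
open import Data.Nat.Properties
open import Data.Product using (∃; ∃-syntax; _×_; _,_; proj₁; proj₂; swap)
open import Data.Sum using (_⊎_; inj₁; inj₂; [_,_]′) renaming (swap to ⊎-swap; map to ⊎-map)
open import Data.Sum.Function.Propositional using (_⊎-⇔_)
open import Function using (id; _∘_)
open import Function.Bundles using (_⇔_; mk⇔; Equivalence)
open import Function.Properties.Equivalence using () renaming (trans to ⇔-trans)
open import Relation.Binary.Definitions using (tri<; tri≈; tri>)
open import Relation.Binary.PropositionalEquality
open import Relation.Nullary using (¬_; Dec; yes; no)

private
  variable
    n m k : ℕ
    M : Matrix n
    x y z : Pos n
    f : ℕ → Pos n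

_≺_ : Pos n → Pos n → Set
x ≺ y = row x < row y × col x < col y

Edge-sym : Edge x y → Edge y x
Edge-sym (inj₁ p) = inj₂ p
Edge-sym (inj₂ p) = inj₁ p

Edge-irrefl : ¬ Edge x x
Edge-irrefl (inj₁ (p , _)) = <-irrefl refl p
Edge-irrefl (inj₂ (p , _)) = <-irrefl refl p

Edge-swap : Edge (swap x) (swap y) → Edge x y
Edge-swap (inj₁ (p , q)) = inj₂ (q , p)
Edge-swap (inj₂ (p , q)) = inj₁ (q , p)

≺-irrefl : ¬ x ≺ x
≺-irrefl (p , _) = <-irrefl refl p

≺-trans : x ≺ y → y ≺ z → x ≺ z
≺-trans (p , q) (p′ , q′) = <-trans p p′ , <-trans q q′

≺⇒¬Edge : x ≺ y → ¬ Edge x y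
≺⇒¬Edge (p , _) (inj₁ (p′ , _)) = <-asym p p′
≺⇒¬Edge (_ , q) (inj₂ (_ , q′)) = <-asym q q′

infixr 5 _◂_

_◂_ : {A : Set} → A → (ℕ → A) → ℕ → A
(a ◂ g) zero    = a
(a ◂ g) (suc i) = g i

◂-all : {A : Set} {P : A → Set} {a : A} {g : ℕ → A} → P a → (∀ i → P (g i)) → ∀ i → P ((a ◂ g) i)
◂-all pa pg zero    = pa
◂-all pa pg (suc i) = pg i

related-from-distances-2-3 : {A : Set} (_R_ : A → A → Set) → (∀ {a b c} → a R b → b R c → a R c) →
  (g : ℕ → A) (m : ℕ) →
  (∀ p → 2 + p ≤ m → g p R g (2 + p)) → (∀ p → 3 + p ≤ m → g p R g (3 + p)) →
  ∀ p q → 2 + p ≤ q → q ≤ m → g p R g q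
related-from-distances-2-3 _R_ R-trans g m step₂ step₃ p q p+2≤q q≤m =
  subst (λ i → g p R g i) (m∸n+n≡m p+2≤q)
        (at-distance (q ∸ (2 + p)) p (subst (_≤ m) (sym (m∸n+n≡m p+2≤q)) q≤m))
  where
  at-distance : ∀ d p → d + (2 + p) ≤ m → g p R g (d + (2 + p))
  at-distance zero          p le = step₂ p le
  at-distance (suc zero)    p le = step₃ p le
  at-distance (suc (suc d)) p le =
    R-trans (step₂ p (≤-trans (m≤n+m (2 + p) (2 + d)) le))
            (subst (λ i → g (2 + p) R g i) shift (at-distance d (2 + p) (subst (_≤ m) (sym shift) le)))
    where
    shift : d + (2 + (2 + p)) ≡ 2 + d + (2 + p)
    shift = trans (+-suc d _) (cong suc (+-suc d _))

record Zigzag (f : ℕ → Pos n) (m : ℕ) : Set where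
  field
    edge  : ∀ p → p < m → Edge (f p) (f (suc p))
    apart : ∀ p q → 2 + p ≤ q → q ≤ m → f p ≺ f q

zigzag-◂ : Zigzag f m → Edge x (f 0) → (∀ q → 1 ≤ q → q ≤ m → x ≺ f q) → Zigzag (x ◂ f) (suc m)
zigzag-◂ {f = f} {m = m} {x = x} Z x—f₀ x≺f = record { edge = edge′ ; apart = apart′ }
  where
  open Zigzag Z
  edge′ : ∀ p → p < suc m → Edge ((x ◂ f) p) ((x ◂ f) (suc p))
  edge′ zero    _         = x—f₀
  edge′ (suc p) (s≤s p<m) = edge p p<m
  apart′ : ∀ p q → 2 + p ≤ q → q ≤ suc m → (x ◂ f) p ≺ (x ◂ f) q
  apart′ zero    (suc q) (s≤s 1≤q) (s≤s q≤m) = x≺f q 1≤q q≤m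
  apart′ (suc p) (suc q) (s≤s le)  (s≤s q≤m) = apart p q le q≤m

zigzag-tail : Zigzag f (suc m) → Zigzag (f ∘ suc) m
zigzag-tail Z = record
  { edge  = λ p p<m → edge (suc p) (s≤s p<m)
  ; apart = λ p q le q≤m → apart (suc p) (suc q) (s≤s le) (s≤s q≤m)
  }
  where open Zigzag Z

module _ {M : Matrix n} {f : ℕ → Pos n} {m : ℕ} (ones : ∀ p → One M (f p)) (Z : Zigzag f m) where
  open Zigzag Z

  private
    adjacent-or-apart : ∀ {p q} → p < q → q ≤ m → q ≡ suc p ⊎ f p ≺ f q
    adjacent-or-apart {p} {q} p<q q≤m with suc p ≟ q
    ... | yes p+1≡q = inj₁ (sym p+1≡q)
    ... | no  p+1≢q = inj₂ (apart p q (≤∧≢⇒< p<q p+1≢q) q≤m)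

    distinct : ∀ {p q} → p < q → q ≤ m → f p ≢ f q
    distinct {p} p<q q≤m fp≡fq with adjacent-or-apart p<q q≤m
    ... | inj₁ refl = Edge-irrefl (subst (Edge (f p)) (sym fp≡fq) (edge p q≤m))
    ... | inj₂ p≺q  = ≺-irrefl (subst (f p ≺_) (sym fp≡fq) p≺q)

    injective : ∀ p q → p ≤ m → q ≤ m → f p ≡ f q → p ≡ q
    injective p q p≤m q≤m fp≡fq with <-cmp p q
    ... | tri< p<q _ _ = ⊥-elim (distinct p<q q≤m fp≡fq)
    ... | tri≈ _ p≡q _ = p≡q
    ... | tri> _ _ q<p = ⊥-elim (distinct q<p p≤m (sym fp≡fq))

    edge⇒adjacent : ∀ p q → p ≤ m → q ≤ m → Edge (f p) (f q) → p + 1 ≡ q ⊎ q + 1 ≡ p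
    edge⇒adjacent p q p≤m q≤m e with <-cmp p q
    ... | tri≈ _ refl _ = ⊥-elim (Edge-irrefl e)
    ... | tri< p<q _ _ with adjacent-or-apart p<q q≤m
    ...   | inj₁ q≡p+1 = inj₁ (trans (+-comm p 1) (sym q≡p+1))
    ...   | inj₂ p≺q   = ⊥-elim (≺⇒¬Edge p≺q e)
    edge⇒adjacent p q p≤m q≤m e | tri> _ _ q<p with adjacent-or-apart q<p p≤m
    ...   | inj₁ p≡q+1 = inj₂ (trans (+-comm q 1) (sym p≡q+1))
    ...   | inj₂ q≺p   = ⊥-elim (≺⇒¬Edge q≺p (Edge-sym e))

    adjacent⇒edge : ∀ p q → q ≤ m → p ≤ m → p + 1 ≡ q ⊎ q + 1 ≡ p → Edge (f p) (f q)
    adjacent⇒edge p q q≤m _ (inj₁ p+1≡q) with trans (+-comm 1 p) p+1≡q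
    ... | refl = edge p q≤m
    adjacent⇒edge p q _ p≤m (inj₂ q+1≡p) with trans (+-comm 1 q) q+1≡p
    ... | refl = Edge-sym (edge q p≤m)

  zigzag⇒oscillation : IsOscillation M (λ (i : Fin (suc m)) → f (toℕ i))
  zigzag⇒oscillation =
    (λ i → ones (toℕ i)) ,
    (λ {i} {j} fi≡fj →
       toℕ-injective (injective (toℕ i) (toℕ j) (toℕ≤pred[n] i) (toℕ≤pred[n] j) fi≡fj)) ,
    (λ i j → mk⇔ (edge⇒adjacent (toℕ i) (toℕ j) (toℕ≤pred[n] i) (toℕ≤pred[n] j))
                 (adjacent⇒edge (toℕ i) (toℕ j) (toℕ≤pred[n] j) (toℕ≤pred[n] i)))

SamePair : {A : Set} → A → A → A → A → Set
SamePair a b c d = (a ≡ c × b ≡ d) ⊎ (a ≡ d × b ≡ c)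

SamePair⇒⇔ : {A : Set} {a b c d : A} → SamePair a b c d →
  ∀ e → (e ≡ a ⊎ e ≡ b) ⇔ (e ≡ c ⊎ e ≡ d)
SamePair⇒⇔ (inj₁ (refl , refl)) e = mk⇔ id id
SamePair⇒⇔ (inj₂ (refl , refl)) e = mk⇔ ⊎-swap ⊎-swap

pair⇔union-of-singletons : {A : Set} {P Q : A → Set} {a b : A} → P a → Q b →
  (∀ {c} → P c → c ≡ a) → (∀ {c} → Q c → c ≡ b) → ∀ c → (c ≡ a ⊎ c ≡ b) ⇔ (P c ⊎ Q c)
pair⇔union-of-singletons pa qb P-unique Q-unique c =
  mk⇔ [ (λ { refl → inj₁ pa }) , (λ { refl → inj₂ qb }) ]′ (⊎-map P-unique Q-unique)

all-or-least-failure : {P : ℕ → Set} → (∀ i → Dec (P i)) → ∀ N →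
  (∀ i → i < N → P i) ⊎ ∃[ j ] (¬ P j × ∀ i → i < j → P i)
all-or-least-failure P? zero = inj₁ (λ _ ())
all-or-least-failure {P = P} P? (suc N) with all-or-least-failure P? N | P? N
... | inj₂ failure | _      = inj₂ failure
... | inj₁ below   | no ¬PN = inj₂ (N , ¬PN , below)
... | inj₁ below   | yes PN =
  inj₁ λ i i<1+N → [ below i , (λ i≡N → subst P (sym i≡N) PN) ]′ (m≤n⇒m<n∨m≡n (≤-pred i<1+N))

max-or-none : {P : Fin n → Set} → (∀ i → Dec (P i)) → (g : Fin n → ℕ) →
  (∀ i → ¬ P i) ⊎ ∃[ i ] (P i × ∀ j → P j → g j ≤ g i)
max-or-none {zero}  P? g = inj₁ (λ ())
max-or-none {suc n} P? g with P? Fin.zero | max-or-none (P? ∘ Fin.suc) (g ∘ Fin.suc)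
... | no ¬P₀ | inj₁ none = inj₁ λ { Fin.zero → ¬P₀ ; (Fin.suc j) → none j }
... | no ¬P₀ | inj₂ (i , Pi , max) =
  inj₂ (Fin.suc i , Pi , λ { Fin.zero P₀ → ⊥-elim (¬P₀ P₀) ; (Fin.suc j) Pj → max j Pj })
... | yes P₀ | inj₁ none =
  inj₂ (Fin.zero , P₀ , λ { Fin.zero _ → ≤-refl ; (Fin.suc j) Pj → ⊥-elim (none j Pj) })
... | yes P₀ | inj₂ (i , Pi , max) with g Fin.zero ≤? g (Fin.suc i)
...   | yes g₀≤ = inj₂ (Fin.suc i , Pi , λ { Fin.zero _ → g₀≤ ; (Fin.suc j) Pj → max j Pj })
...   | no  g₀≰ =
  inj₂ (Fin.zero , P₀ , λ { Fin.zero _ → ≤-refl ; (Fin.suc j) Pj → ≤-trans (max j Pj) (<⇒≤ (≰⇒> g₀≰)) })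

argmax : {P : Fin n → Set} → (∀ i → Dec (P i)) → (g : Fin n → ℕ) → ∀ i₀ → P i₀ →
  ∃[ i ] (P i × ∀ j → P j → g j ≤ g i)
argmax P? g i₀ P₀ with max-or-none P? g
... | inj₁ none = ⊥-elim (none i₀ P₀)
... | inj₂ max  = max

closed-upper-left-block-is-total : SumIndecomposable M → ∀ h c →
  (∀ y → One M y → row y ≤ h → col y ≤ c) → (∀ y → One M y → col y ≤ c → row y ≤ h) →
  ∀ x → One M x → row x ≤ h → ∀ y → One M y → row y ≤ h
closed-upper-left-block-is-total {M = M} indec h c rows⇒cols cols⇒rows x ox x≤h y oy with row y ≤? h
... | yes y≤h = y≤h
... | no  y≰h = ⊥-elim (indec (suc h , suc c , ≤-trans h<y (<⇒≤ (toℕ<n (proj₁ y))) ,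
                               ≤-trans (bottom-left y oy h<y) (<⇒≤ (toℕ<n (proj₂ y))) ,
                               top-right , bottom-left ,
                               (x , ox , s≤s x≤h , s≤s (rows⇒cols x ox x≤h)) ,
                               (y , oy , h<y , bottom-left y oy h<y)))
  where
  h<y : h < row y
  h<y = ≰⇒> y≰h
  top-right : ∀ z → One M z → row z < suc h → col z < suc c
  top-right z oz (s≤s z≤h) = s≤s (rows⇒cols z oz z≤h)
  bottom-left : ∀ z → One M z → suc h ≤ row z → suc c ≤ col z
  bottom-left z oz h<z with col z ≤? c
  ... | yes z≤c = ⊥-elim (<⇒≱ h<z (cols⇒rows z oz z≤c))
  ... | no  z≰c = ≰⇒> z≰c

leftmost-exists : {M : Matrix n} → IsPermutationMatrix M → Pos n → ∃ (IsLeftmost M)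
leftmost-exists {n = suc _} (_ , cols) _ =
  (proj₁ (cols Fin.zero) , Fin.zero) , proj₁ (proj₂ (cols Fin.zero)) , λ _ _ → z≤n

rightmost-exists : {M : Matrix n} → IsPermutationMatrix M → Pos n → ∃ (IsRightmost M)
rightmost-exists {n = suc n} (_ , cols) _ =
  (proj₁ (cols (fromℕ n)) , fromℕ n) , proj₁ (proj₂ (cols (fromℕ n))) ,
  λ y _ → subst (col y ≤_) (sym (toℕ-fromℕ n)) (toℕ≤pred[n] (proj₂ y))

module PermutationMatrix {M : Matrix n} (perm : IsPermutationMatrix M) where

  private
    colOfRow rowOfCol : Fin n → Fin n
    colOfRow i = proj₁ (proj₁ perm i)
    rowOfCol j = proj₁ (proj₂ perm j)

    colOfRow-one : ∀ i → M i (colOfRow i) ≡ true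
    colOfRow-one i = proj₁ (proj₂ (proj₁ perm i))

    rowOfCol-one : ∀ j → M (rowOfCol j) j ≡ true
    rowOfCol-one j = proj₁ (proj₂ (proj₂ perm j))

    colOfRow-unique : ∀ {i j} → M i j ≡ true → colOfRow i ≡ j
    colOfRow-unique {i} = proj₂ (proj₂ (proj₁ perm i))

    rowOfCol-unique : ∀ {i j} → M i j ≡ true → rowOfCol j ≡ i
    rowOfCol-unique {j = j} = proj₂ (proj₂ (proj₂ perm j))

  same-row⇒≡ : One M x → One M y → row x ≡ row y → x ≡ y
  same-row⇒≡ {x = i , j} {y = i′ , j′} ox oy eq with toℕ-injective eq
  ... | refl = cong (i ,_) (trans (sym (colOfRow-unique ox)) (colOfRow-unique oy))

  same-col⇒≡ : One M x → One M y → col x ≡ col y → x ≡ y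
  same-col⇒≡ {x = i , j} {y = i′ , j′} ox oy eq with toℕ-injective eq
  ... | refl = cong (_, j) (trans (sym (rowOfCol-unique ox)) (rowOfCol-unique oy))

  row≤∧col≢⇒row< : One M x → One M y → row x ≤ row y → col x ≢ col y → row x < row y
  row≤∧col≢⇒row< ox oy x≤y cols≢ = ≤∧≢⇒< x≤y (cols≢ ∘ cong col ∘ same-row⇒≡ ox oy)

  col≤∧row≢⇒col< : One M x → One M y → col x ≤ col y → row x ≢ row y → col x < col y
  col≤∧row≢⇒col< ox oy x≤y rows≢ = ≤∧≢⇒< x≤y (rows≢ ∘ cong row ∘ same-col⇒≡ ox oy)

  leftmost-unique : IsLeftmost M x → IsLeftmost M y → x ≡ y
  leftmost-unique (ox , x≤) (oy , y≤) = same-col⇒≡ ox oy (≤-antisym (x≤ _ oy) (y≤ _ ox))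

  rightmost-unique : IsRightmost M x → IsRightmost M y → x ≡ y
  rightmost-unique (ox , ≤x) (oy , ≤y) = same-col⇒≡ ox oy (≤-antisym (≤y _ ox) (≤x _ oy))

  topmost-unique : IsTopmost M x → IsTopmost M y → x ≡ y
  topmost-unique (ox , x≤) (oy , y≤) = same-row⇒≡ ox oy (≤-antisym (x≤ _ oy) (y≤ _ ox))

  bottommost-unique : IsBottommost M x → IsBottommost M y → x ≡ y
  bottommost-unique (ox , ≤x) (oy , ≤y) = same-row⇒≡ ox oy (≤-antisym (≤y _ ox) (≤x _ oy))

  private
    rowOfRightmostAbove : (x : Pos n) →
      ∃[ i ] (toℕ i ≤ row x × ∀ i′ → toℕ i′ ≤ row x → toℕ (colOfRow i′) ≤ toℕ (colOfRow i))
    rowOfRightmostAbove x = argmax (λ i → toℕ i ≤? row x) (toℕ ∘ colOfRow) (proj₁ x) ≤-refl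

    colOfBottommostLeft : (x : Pos n) →
      ∃[ j ] (toℕ j ≤ col x × ∀ j′ → toℕ j′ ≤ col x → toℕ (rowOfCol j′) ≤ toℕ (rowOfCol j))
    colOfBottommostLeft x = argmax (λ j → toℕ j ≤? col x) (toℕ ∘ rowOfCol) (proj₂ x) ≤-refl

  rightmostAbove bottommostLeft : Pos n → Pos n
  rightmostAbove x = let i = proj₁ (rowOfRightmostAbove x) in i , colOfRow i
  bottommostLeft x = let j = proj₁ (colOfBottommostLeft x) in rowOfCol j , j

  rightmostAbove-one : ∀ x → One M (rightmostAbove x)
  rightmostAbove-one x = colOfRow-one (proj₁ (rowOfRightmostAbove x))

  rightmostAbove-row≤ : ∀ x → row (rightmostAbove x) ≤ row x
  rightmostAbove-row≤ x = proj₁ (proj₂ (rowOfRightmostAbove x))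

  rightmostAbove-max : ∀ x y → One M y → row y ≤ row x → col y ≤ col (rightmostAbove x)
  rightmostAbove-max x (i , j) oy y≤x with colOfRow-unique oy
  ... | refl = proj₂ (proj₂ (rowOfRightmostAbove x)) i y≤x

  bottommostLeft-one : ∀ x → One M (bottommostLeft x)
  bottommostLeft-one x = rowOfCol-one (proj₁ (colOfBottommostLeft x))

  bottommostLeft-col≤ : ∀ x → col (bottommostLeft x) ≤ col x
  bottommostLeft-col≤ x = proj₁ (proj₂ (colOfBottommostLeft x))

  bottommostLeft-max : ∀ x y → One M y → col y ≤ col x → row y ≤ row (bottommostLeft x)
  bottommostLeft-max x (i , j) oy y≤x with rowOfCol-unique oy
  ... | refl = proj₂ (proj₂ (colOfBottommostLeft x)) j y≤x

  rightmostAbove-topmost : IsTopmost M x → rightmostAbove x ≡ x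
  rightmostAbove-topmost {x = x} (ox , x≤) =
    same-row⇒≡ (rightmostAbove-one x) ox (≤-antisym (rightmostAbove-row≤ x) (x≤ _ (rightmostAbove-one x)))

  bottommostLeft-leftmost : IsLeftmost M x → bottommostLeft x ≡ x
  bottommostLeft-leftmost {x = x} (ox , x≤) =
    same-col⇒≡ (bottommostLeft-one x) ox (≤-antisym (bottommostLeft-col≤ x) (x≤ _ (bottommostLeft-one x)))

  rightmostAbove-bottommost : IsBottommost M x → IsRightmost M y → rightmostAbove x ≡ y
  rightmostAbove-bottommost {x = x} {y = y} (_ , ≤x) (oy , ≤y) =
    same-col⇒≡ (rightmostAbove-one x) oy
      (≤-antisym (≤y _ (rightmostAbove-one x)) (rightmostAbove-max x y oy (≤x y oy)))

  bottommostLeft-rightmost : IsRightmost M x → IsBottommost M y → bottommostLeft x ≡ y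
  bottommostLeft-rightmost {x = x} {y = y} (_ , ≤x) (oy , ≤y) =
    same-row⇒≡ (bottommostLeft-one x) oy
      (≤-antisym (≤y _ (bottommostLeft-one x)) (bottommostLeft-max x y oy (≤x y oy)))

module _ (perm : IsPermutationMatrix M) {l t b r : Pos n}
         (isL : IsLeftmost M l) (isT : IsTopmost M t) (isB : IsBottommost M b) (isR : IsRightmost M r) where
  open PermutationMatrix perm

  zigzag⇒spanning-oscillation : (∀ p → One M (f p)) → Zigzag f (suc k) →
    SamePair (f 0) (f 1) l t → SamePair (f k) (f (suc k)) b r → HasSpanningOscillation M
  zigzag⇒spanning-oscillation {f = f} {k = k} ones Z start end =
    k , (λ i → f (toℕ i)) , zigzag⇒oscillation {M = M} ones Z ,
    (λ z → ⇔-trans (SamePair⇒⇔ start z) (starts z)) ,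
    (λ z → subst₂ (λ p q → (z ≡ f p ⊎ z ≡ f q) ⇔ (IsBottommost M z ⊎ IsRightmost M z))
                  (sym k-index) (sym (toℕ-fromℕ (suc k)))
                  (⇔-trans (SamePair⇒⇔ end z) (ends z)))
    where
    starts : ∀ z → (z ≡ l ⊎ z ≡ t) ⇔ (IsLeftmost M z ⊎ IsTopmost M z)
    starts = pair⇔union-of-singletons isL isT (λ h → leftmost-unique h isL) (λ h → topmost-unique h isT)
    ends : ∀ z → (z ≡ b ⊎ z ≡ r) ⇔ (IsBottommost M z ⊎ IsRightmost M z)
    ends = pair⇔union-of-singletons isB isR (λ h → bottommost-unique h isB) (λ h → rightmost-unique h isR)
    k-index : toℕ (inject₁ (fromℕ k)) ≡ k
    k-index = trans (toℕ-inject₁ (fromℕ k)) (toℕ-fromℕ k)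

module Walk (perm : IsPermutationMatrix M) (indec : SumIndecomposable M) {l t b r : Pos n}
            (isL : IsLeftmost M l) (isT : IsTopmost M t) (isB : IsBottommost M b) (isR : IsRightmost M r)
            (t-left-of-b : col t < col b) where
  open PermutationMatrix perm

  row-grows : ∀ x → One M x → row x < row b → row x < row (bottommostLeft (rightmostAbove x))
  row-grows x ox x<b with row (bottommostLeft (rightmostAbove x)) ≤? row x
  ... | no  ≰x = ≰⇒> ≰x
  ... | yes ≤x = ⊥-elim (<⇒≱ x<b
        (closed-upper-left-block-is-total indec (row x) (col (rightmostAbove x))
          (rightmostAbove-max x)
          (λ y oy y≤ → ≤-trans (bottommostLeft-max (rightmostAbove x) y oy y≤) ≤x)
          x ox ≤-refl b (proj₁ isB)))

  col-grows : ∀ x → One M x → col x < col r → col x < col (rightmostAbove (bottommostLeft x))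
  col-grows x ox x<r with col (rightmostAbove (bottommostLeft x)) ≤? col x
  ... | no  ≰x = ≰⇒> ≰x
  ... | yes ≤x = ⊥-elim (<⇒≱ x<r (≤-trans (rightmostAbove-max L r (proj₁ isR) r-above-L) ≤x))
    where
    L : Pos n
    L = bottommostLeft x
    rows⇒cols : ∀ y → One M y → row y ≤ row L → col y ≤ col x
    rows⇒cols y oy y≤ = ≤-trans (rightmostAbove-max L y oy y≤) ≤x
    r-above-L : row r ≤ row L
    r-above-L = closed-upper-left-block-is-total indec (row L) (col x) rows⇒cols (bottommostLeft-max x)
                  L (bottommostLeft-one x) ≤-refl r (proj₁ isR)

  Step : Bool → Pos n → Pos n
  Step true  = rightmostAbove
  Step false = bottommostLeft

  BeforeEnd : Bool → Pos n → Set
  BeforeEnd true  x = row x < row b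
  BeforeEnd false x = col x < col r

  BeforeEnd? : ∀ s x → Dec (BeforeEnd s x)
  BeforeEnd? true  x = row x <? row b
  BeforeEnd? false x = col x <? col r

  step-one : ∀ s x → One M (Step s x)
  step-one true  = rightmostAbove-one
  step-one false = bottommostLeft-one

  step-edge : ∀ s x → One M x → BeforeEnd s x → Edge (Step s x) (Step (not s) (Step s x))
  step-edge false x ox x<r = inj₁ (row≤∧col≢⇒row< (rightmostAbove-one L) (bottommostLeft-one x)
                                     (rightmostAbove-row≤ L) (>⇒≢ L<U) , L<U)
    where
    L : Pos n
    L = bottommostLeft x
    L<U : col L < col (rightmostAbove L)
    L<U = ≤-<-trans (bottommostLeft-col≤ x) (col-grows x ox x<r)
  step-edge true x ox x<b = inj₂ (U<L , col≤∧row≢⇒col< (bottommostLeft-one U) (rightmostAbove-one x)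
                                          (bottommostLeft-col≤ U) (>⇒≢ U<L))
    where
    U : Pos n
    U = rightmostAbove x
    U<L : row U < row (bottommostLeft U)
    U<L = ≤-<-trans (rightmostAbove-row≤ x) (row-grows x ox x<b)

  step-apart₂ : ∀ s x → One M x → BeforeEnd (not s) (Step s x) →
    Step s x ≺ Step (not (not s)) (Step (not s) (Step s x))
  step-apart₂ false x ox L<b = L<L′ , ≤-<-trans (bottommostLeft-col≤ x) x<L′
    where
    L : Pos n
    L = bottommostLeft x
    L′ : Pos n
    L′ = bottommostLeft (rightmostAbove L)
    L<L′ : row L < row L′
    L<L′ = row-grows L (bottommostLeft-one x) L<b
    x<L′ : col x < col L′
    x<L′ = ≰⇒> λ L′≤x →
      <⇒≱ L<L′ (bottommostLeft-max x L′ (bottommostLeft-one (rightmostAbove L)) L′≤x)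
  step-apart₂ true x ox U<r = ≤-<-trans (rightmostAbove-row≤ x) x<U′ , U<U′
    where
    U : Pos n
    U = rightmostAbove x
    U′ : Pos n
    U′ = rightmostAbove (bottommostLeft U)
    U<U′ : col U < col U′
    U<U′ = col-grows U (rightmostAbove-one x) U<r
    x<U′ : row x < row U′
    x<U′ = ≰⇒> λ U′≤x →
      <⇒≱ U<U′ (rightmostAbove-max x U′ (rightmostAbove-one (bottommostLeft U)) U′≤x)

  step-apart₃ : ∀ s x → One M x → BeforeEnd s x → BeforeEnd (not (not s)) (Step (not s) (Step s x)) →
    Step s x ≺ Step (not (not (not s))) (Step (not (not s)) (Step (not s) (Step s x)))
  step-apart₃ false x ox _ U<r =
    L<U′ , ≤-<-trans (rightmostAbove-max L L (bottommostLeft-one x) ≤-refl) U<U′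
    where
    L : Pos n
    L = bottommostLeft x
    U : Pos n
    U = rightmostAbove L
    U′ : Pos n
    U′ = rightmostAbove (bottommostLeft U)
    U<U′ : col U < col U′
    U<U′ = col-grows U (rightmostAbove-one L) U<r
    L<U′ : row L < row U′
    L<U′ = ≰⇒> λ U′≤L →
      <⇒≱ U<U′ (rightmostAbove-max L U′ (rightmostAbove-one (bottommostLeft U)) U′≤L)
  step-apart₃ true x ox x<b L<b = <-trans U<L L<L″ , U<L″
    where
    U : Pos n
    U = rightmostAbove x
    L : Pos n
    L = bottommostLeft U
    L″ : Pos n
    L″ = bottommostLeft (rightmostAbove L)
    U<L : row U < row L
    U<L = ≤-<-trans (rightmostAbove-row≤ x) (row-grows x ox x<b)
    L<L″ : row L < row L″
    L<L″ = row-grows L (bottommostLeft-one U) L<b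
    U<L″ : col U < col L″
    U<L″ = ≰⇒> λ L″≤U →
      <⇒≱ L<L″ (bottommostLeft-max U L″ (bottommostLeft-one (rightmostAbove L)) L″≤U)

  step-end : ∀ s x → One M x → ¬ BeforeEnd s x → SamePair x (Step s x) b r
  step-end true x ox x≮b = inj₁ (x≡b , trans (cong rightmostAbove x≡b) (rightmostAbove-bottommost isB isR))
    where
    x≡b : x ≡ b
    x≡b = bottommost-unique (ox , λ y oy → ≤-trans (proj₂ isB y oy) (≮⇒≥ x≮b)) isB
  step-end false x ox x≮r = inj₂ (x≡r , trans (cong bottommostLeft x≡r) (bottommostLeft-rightmost isR isB))
    where
    x≡r : x ≡ r
    x≡r = rightmost-unique (ox , λ y oy → ≤-trans (proj₂ isR y oy) (≮⇒≥ x≮r)) isR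

  parity : ℕ → Bool
  parity zero    = false
  parity (suc i) = not (parity i)

  walk : ℕ → Pos n
  walk zero    = l
  walk (suc i) = Step (parity i) (walk i)

  walk-one : ∀ i → One M (walk i)
  walk-one zero    = proj₁ isL
  walk-one (suc i) = step-one (parity i) (walk i)

  Continues : ℕ → Set
  Continues i = BeforeEnd (parity i) (walk i)

  double : ℕ → ℕ
  double zero    = zero
  double (suc k) = suc (suc (double k))

  parity-double : ∀ k → parity (double k) ≡ false
  parity-double zero = refl
  parity-double (suc k) rewrite parity-double k = refl

  col-walk-double : ∀ k → (∀ i → i < double k → Continues i) → k ≤ col (walk (double k))
  col-walk-double zero    _         = z≤n
  col-walk-double (suc k) continues with continues (double k) (m<n⇒m<1+n (n<1+n _))
  ... | continues₂ₖ rewrite parity-double k =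
    ≤-<-trans (col-walk-double k (λ i i< → continues i (m<n⇒m<1+n (m<n⇒m<1+n i<))))
              (col-grows (walk (double k)) (walk-one (double k)) continues₂ₖ)

  walk-stops : ∃[ j ] (¬ Continues j × ∀ i → i < j → Continues i)
  walk-stops with all-or-least-failure (λ i → BeforeEnd? (parity i) (walk i)) (double n)
  ... | inj₁ continues = ⊥-elim (<⇒≱ (toℕ<n (proj₂ (walk (double n)))) (col-walk-double n continues))
  ... | inj₂ stop      = stop

  path : ℕ → Pos n
  path = walk ∘ suc

  path-zigzag : ∀ j → (∀ i → i < j → Continues i) → Zigzag path j
  path-zigzag j continues = record
    { edge  = λ p p<j → step-edge (parity p) (walk p) (walk-one p) (continues p p<j)
    ; apart = related-from-distances-2-3 _≺_ ≺-trans path j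
        (λ p p+2≤j → step-apart₂ (parity p) (walk p) (walk-one p) (continues (suc p) p+2≤j))
        (λ p p+3≤j → step-apart₃ (parity p) (walk p) (walk-one p)
                       (continues p (≤-trans (m≤n+m (suc p) 2) p+3≤j)) (continues (2 + p) p+3≤j))
    }

  walk₁≡l : walk 1 ≡ l
  walk₁≡l = bottommostLeft-leftmost isL

  t-left-of-r : col t < col r
  t-left-of-r = <-≤-trans t-left-of-b (proj₂ isR b (proj₁ isB))

  end-right-of-t : SamePair x y b r → col t < col x × col t < col y
  end-right-of-t (inj₁ (refl , refl)) = t-left-of-b , t-left-of-r
  end-right-of-t (inj₂ (refl , refl)) = t-left-of-r , t-left-of-b

  continues-at-0 : Continues 0
  continues-at-0 = ≤-<-trans (proj₂ isL t (proj₁ isT)) t-left-of-r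

  module AfterStop (j : ℕ) (continues : ∀ i → i < 2 + j → Continues i) (stops : ¬ Continues (2 + j)) where

    Z : Zigzag path (2 + j)
    Z = path-zigzag (2 + j) continues

    end : SamePair (path (suc j)) (path (2 + j)) b r
    end = step-end (parity (2 + j)) (walk (2 + j)) (walk-one (2 + j)) stops

    spanning : (∀ p → One M (f p)) → Zigzag f (suc k) →
      SamePair (f 0) (f 1) l t → SamePair (f k) (f (suc k)) b r → HasSpanningOscillation M
    spanning = zigzag⇒spanning-oscillation perm isL isT isB isR

    walk₂-is-t : walk 2 ≡ t → HasSpanningOscillation M
    walk₂-is-t walk₂≡t = spanning (walk-one ∘ suc) Z (inj₁ (walk₁≡l , walk₂≡t)) end

    module _ (walk₂≢t : col (walk 2) ≢ col t) where

      t≺walk₂ : t ≺ walk 2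
      t≺walk₂ = row≤∧col≢⇒row< (proj₁ isT) (walk-one 2) (proj₂ isT _ (walk-one 2)) (walk₂≢t ∘ sym) ,
                ≤∧≢⇒< (rightmostAbove-max (walk 1) t (proj₁ isT) (proj₂ isT _ (walk-one 1))) (walk₂≢t ∘ sym)

      t-above-l : row t < row l
      t-above-l = ≤∧≢⇒< (proj₂ isT l (proj₁ isL)) λ rows≡ → walk₂≢t (cong col (begin
        walk 2            ≡⟨ cong rightmostAbove walk₁≡l ⟩
        rightmostAbove l  ≡⟨ cong rightmostAbove (same-row⇒≡ (proj₁ isL) (proj₁ isT) (sym rows≡)) ⟩
        rightmostAbove t  ≡⟨ rightmostAbove-topmost isT ⟩
        t                 ∎))
        where open ≡-Reasoning

      l-left-of-t : col l < col t
      l-left-of-t = ≤∧≢⇒< (proj₂ isL t (proj₁ isT))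
                          (<⇒≢ t-above-l ∘ cong row ∘ sym ∘ same-col⇒≡ (proj₁ isL) (proj₁ isT))

      t—l : Edge t l
      t—l = inj₂ (t-above-l , l-left-of-t)

      walk₃-off-column-of-t : col (walk 3) ≢ col t
      walk₃-off-column-of-t cols≡ =
        ≺⇒¬Edge t≺walk₂ (Edge-sym (subst (Edge (walk 2)) (same-col⇒≡ (walk-one 3) (proj₁ isT) cols≡)
                                         (Zigzag.edge Z 1 (s≤s (s≤s z≤n)))))

      t-prepended : col t < col (walk 3) → HasSpanningOscillation M
      t-prepended t<walk₃ =
        spanning (◂-all {P = One M} (proj₁ isT) (walk-one ∘ suc))
                 (zigzag-◂ Z (subst (Edge t) (sym walk₁≡l) t—l) t≺path)
                 (inj₂ (refl , walk₁≡l)) end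
        where
        t≺path : ∀ q → 1 ≤ q → q ≤ 2 + j → t ≺ path q
        t≺path 1 _ _ = t≺walk₂
        t≺path 2 _ _ =
          row≤∧col≢⇒row< (proj₁ isT) (walk-one 3) (proj₂ isT _ (walk-one 3)) (<⇒≢ t<walk₃) , t<walk₃
        t≺path (suc (suc (suc q))) _ q≤ =
          ≺-trans t≺walk₂ (Zigzag.apart Z 1 (3 + q) (s≤s (s≤s (s≤s z≤n))) q≤)

      t-replaces-walk₂ : col (walk 3) < col t → HasSpanningOscillation M
      t-replaces-walk₂ walk₃<t = replace j Z end
        where
        t—walk₃ : Edge t (walk 3)
        t—walk₃ = inj₂ (≤-<-trans (proj₂ isT _ (walk-one 1))
                                  (proj₁ (Zigzag.apart Z 0 2 ≤-refl (s≤s (s≤s z≤n)))) ,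
                        walk₃<t)
        replace : ∀ j′ → Zigzag path (2 + j′) → SamePair (path (suc j′)) (path (2 + j′)) b r →
          HasSpanningOscillation M
        replace zero     _  end′ = ⊥-elim (<-asym walk₃<t (proj₂ (end-right-of-t end′)))
        replace (suc j′) Z′ end′ =
          spanning (◂-all {P = One M} (proj₁ isL)
                     (◂-all {P = One M} (proj₁ isT) (walk-one ∘ suc ∘ suc ∘ suc)))
                   (zigzag-◂ (zigzag-◂ (zigzag-tail (zigzag-tail Z′)) t—walk₃ t≺later)
                             (Edge-sym t—l) l≺later)
                   (inj₁ (refl , refl)) end′
          where
          t≺later : ∀ q → 1 ≤ q → q ≤ suc j′ → t ≺ path (2 + q)
          t≺later (suc q) _ q≤ =
            ≺-trans t≺walk₂ (Zigzag.apart Z′ 1 (3 + q) (s≤s (s≤s (s≤s z≤n))) (s≤s (s≤s q≤)))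
          l≺later : ∀ q → 1 ≤ q → q ≤ 2 + j′ → l ≺ (t ◂ path ∘ suc ∘ suc) q
          l≺later (suc q) _ q≤ =
            subst (_≺ path (2 + q)) walk₁≡l (Zigzag.apart Z′ 0 (2 + q) (s≤s (s≤s z≤n)) (s≤s q≤))

    spanning-oscillation : HasSpanningOscillation M
    spanning-oscillation with col (walk 2) ≟ col t
    ... | yes cols≡ = walk₂-is-t (same-col⇒≡ (walk-one 2) (proj₁ isT) cols≡)
    ... | no  cols≢ with <-cmp (col (walk 3)) (col t)
    ...   | tri< walk₃<t _ _ = t-replaces-walk₂ cols≢ walk₃<t
    ...   | tri≈ _ cols≡ _   = ⊥-elim (walk₃-off-column-of-t cols≢ cols≡)
    ...   | tri> _ _ t<walk₃ = t-prepended cols≢ t<walk₃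

  spanning-oscillation : HasSpanningOscillation M
  spanning-oscillation with walk-stops
  ... | zero , stops , _ = ⊥-elim (stops continues-at-0)
  ... | suc zero , stops , _ =
    ⊥-elim (<⇒≱ (proj₁ (end-right-of-t (step-end true (walk 1) (walk-one 1) stops)))
                (≤-trans (bottommostLeft-col≤ l) (proj₂ isL t (proj₁ isT))))
  ... | suc (suc j) , stops , continues = AfterStop.spanning-oscillation j continues stops

spanning-oscillation-if-t-left-of-b : IsPermutationMatrix M → SumIndecomposable M →
  (∃[ t ] ∃[ b ] (IsTopmost M t × IsBottommost M b × col t < col b)) → HasSpanningOscillation M
spanning-oscillation-if-t-left-of-b perm indec (t , b , isT , isB , t<b)
  with leftmost-exists perm t | rightmost-exists perm t
... | l , isL | r , isR = Walk.spanning-oscillation perm indec isL isT isB isR t<b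

transpose : Matrix n → Matrix n
transpose M i j = M j i

transpose-permutation : IsPermutationMatrix M → IsPermutationMatrix (transpose M)
transpose-permutation (rows , cols) = cols , rows

transpose-indecomposable : SumIndecomposable M → SumIndecomposable (transpose M)
transpose-indecomposable {M = M} indec
  (a , c , a≤n , c≤n , top-right , bottom-left , (x , ox , x<a , x<c) , (y , oy , a≤y , c≤y)) =
  indec (c , a , c≤n , a≤n , top-right′ , bottom-left′ ,
         (swap x , ox , x<c , x<a) , (swap y , oy , c≤y , a≤y))
  where
  top-right′ : ∀ z → One M z → row z < c → col z < a
  top-right′ z oz z<c with col z <? a
  ... | yes z<a = z<a
  ... | no  z≮a = ⊥-elim (<⇒≱ z<c (bottom-left (swap z) oz (≮⇒≥ z≮a)))
  bottom-left′ : ∀ z → One M z → c ≤ row z → a ≤ col z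
  bottom-left′ z oz c≤z with col z <? a
  ... | yes z<a = ⊥-elim (<⇒≱ (top-right (swap z) oz z<a) c≤z)
  ... | no  z≮a = ≮⇒≥ z≮a

topmost-transpose : IsTopmost (transpose M) (swap x) ⇔ IsLeftmost M x
topmost-transpose = mk⇔ (λ (o , h) → o , h ∘ swap) (λ (o , h) → o , h ∘ swap)

leftmost-transpose : IsLeftmost (transpose M) (swap x) ⇔ IsTopmost M x
leftmost-transpose = mk⇔ (λ (o , h) → o , h ∘ swap) (λ (o , h) → o , h ∘ swap)

bottommost-transpose : IsBottommost (transpose M) (swap x) ⇔ IsRightmost M x
bottommost-transpose = mk⇔ (λ (o , h) → o , h ∘ swap) (λ (o , h) → o , h ∘ swap)

rightmost-transpose : IsRightmost (transpose M) (swap x) ⇔ IsBottommost M x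
rightmost-transpose = mk⇔ (λ (o , h) → o , h ∘ swap) (λ (o , h) → o , h ∘ swap)

spanning-oscillation-transpose : HasSpanningOscillation (transpose M) → HasSpanningOscillation M
spanning-oscillation-transpose {M = M} (k , xs , (ones , injective , edges) , starts , ends) =
  k , swap ∘ xs , (ones , injective ∘ cong swap , λ p q → ⇔-trans (mk⇔ Edge-swap Edge-swap) (edges p q)) ,
  (λ z → ⇔-trans (swap-≡ ⊎-⇔ swap-≡)
           (⇔-trans (starts (swap z)) (⇔-trans (leftmost-transpose ⊎-⇔ topmost-transpose) ⊎-comm))) ,
  (λ z → ⇔-trans (swap-≡ ⊎-⇔ swap-≡)
           (⇔-trans (ends (swap z)) (⇔-trans (bottommost-transpose ⊎-⇔ rightmost-transpose) ⊎-comm)))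
  where
  swap-≡ : ∀ {z x : Pos _} → (z ≡ swap x) ⇔ (swap z ≡ x)
  swap-≡ = mk⇔ (cong swap) (cong swap)
  ⊎-comm : ∀ {A B : Set} → (A ⊎ B) ⇔ (B ⊎ A)
  ⊎-comm = mk⇔ ⊎-swap ⊎-swap

lemma1p9 : (n : ℕ) (M : Matrix n) → IsPermutationMatrix M → SumIndecomposable M →
    ((∃[ t ] ∃[ b ] (IsTopmost M t × IsBottommost M b × col t < col b))
      ⊎ (∃[ l ] ∃[ r ] (IsLeftmost M l × IsRightmost M r × row l < row r))) →
    HasSpanningOscillation M
lemma1p9 n M perm indec (inj₁ t-left-of-b) = spanning-oscillation-if-t-left-of-b perm indec t-left-of-b
lemma1p9 n M perm indec (inj₂ (l , r , isL , isR , l-above-r)) =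
  spanning-oscillation-transpose
    (spanning-oscillation-if-t-left-of-b (transpose-permutation perm) (transpose-indecomposable indec)
      (swap l , swap r , Equivalence.from topmost-transpose isL ,
       Equivalence.from bottommost-transpose isR , l-above-r))
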